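{- Let $n, r \in \mathbb{N}^*$ and let $G = C_n^r$ (the direct sum of $r$ copies of the cyclic group of order $n$). Suppose that every zero-sumfree sequence $S$ in $G$ with $|S| \geq r(n-1)$ satisfies $\mathsf{k}(S) \leq r\cdot\frac{n-1}{n}$. Then $\mathsf{D}(C_n^r) = r(n-1)+1$. Moreover, every zero-sumfree sequence $S$ in $C_n^r$ with $|S| = \mathsf{D}(C_n^r)-1 = r(n-1)$ consists only of elements of order $n$.
   Context: A sequence in a finite abelian group $G$ (written additively) is a finite list $S=(g_1,\dots,g_\ell)$ of elements of $G$ (repetitions allowed), of length $|S|=\ell$. $S$ is zero-sumfree if $\sum_{i\in I} g_i \neq 0$ for every non-empty $I \subseteq \{1,\dots,\ell\}$. The cross number of $S$ is $\mathsf{k}(S)=\sum_{i=1}^{\ell} \frac{1}{\mathrm{ord}(g_i)}$. The Davenport constant $\mathsf{D}(G)$ is the smallest positive integer $t$ such that every sequence in $G$ of length at least $t$ has a non-empty subsequence with sum $0$. -}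

module Defs where

open import Data.Nat using (ℕ; zero; suc; _+_; _*_; _∸_; _≤_; NonZero)
open import Data.Nat.DivMod using (_mod_)
open import Data.Fin using (Fin; toℕ)
import Data.Fin.Properties as FinP
open import Data.Vec using (Vec; replicate; zipWith)
open import Data.Vec.Properties using (≡-dec)
open import Data.List using (List; []; _∷_; foldr; length)
open import Data.List.Relation.Binary.Sublist.Propositional using (_⊆_)
open import Data.List.Relation.Unary.All using (All)
open import Data.Integer using (+_)
import Data.Rational as ℚ
open import Relation.Nullary using (¬_; yes; no)
open import Relation.Binary.PropositionalEquality using (_≡_; _≢_)

-- The group C_n^r, realised as vectors of length r over ℤ/nℤ = Fin n,
-- with componentwise addition modulo n.
G : (n r : ℕ) → Set
G n r = Vec (Fin n) r

module _ (n r : ℕ) .{{_ : NonZero n}} where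

  0G : G n r
  0G = replicate r (0 mod n)

  _+G_ : G n r → G n r → G n r
  _+G_ = zipWith (λ a b → (toℕ a + toℕ b) mod n)

  _·G_ : ℕ → G n r → G n r
  zero  ·G g = 0G
  suc k ·G g = g +G (k ·G g)

  σ : List (G n r) → G n r
  σ = foldr _+G_ 0G

  ZeroSumFree : List (G n r) → Set
  ZeroSumFree S = ∀ T → T ⊆ S → T ≢ [] → σ T ≢ 0G

  -- order of g: the least k ≥ 1 with k · g = 0 (found by bounded search
  -- over k = 1, …, n; since n · g = 0 the search always succeeds).
  -- ordSearch fuel k g returns (the least k' ≥ suc k with k' · g = 0) ∸ 1.
  ordSearch : ℕ → ℕ → G n r → ℕ
  ordSearch zero     k g = k
  ordSearch (suc f) k g with ≡-dec FinP._≟_ (suc k ·G g) 0G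
  ... | yes _ = k
  ... | no  _ = ordSearch f (suc k) g

  ord : G n r → ℕ
  ord g = suc (ordSearch n 0 g)

  crossNumber : List (G n r) → ℚ.ℚ
  crossNumber = foldr (λ g q → ((+ 1) ℚ./ ord g) ℚ.+ q) ℚ.0ℚ

  DavenportBound : ℕ → Set
  DavenportBound t = ∀ (S : List (G n r)) → t ≤ length S → ¬ ZeroSumFree S

  IsDavenportConstant : ℕ → Set
  IsDavenportConstant t =
    1 ≤ t × DavenportBound t × (∀ t′ → 1 ≤ t′ → DavenportBound t′ → t ≤ t′)
    where open import Data.Product using (_×_)

module Submission where

-- Proposition 2.1 for G = C_n^r, n = m + 1.  Three facts drive the proof.
--  (1) n·g = 0 for every g, so every element has order at most n (ord≤n).
--  (2) Hence the cross number of a sequence S is at least |S|/n, and strictly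
--      larger as soon as one term has order < n (cross≥, cross>).
--  (3) n - 1 copies of each standard basis vector form a zero-sumfree sequence
--      of length r(n-1) (standardSequence); it is built one coordinate at a
--      time by the direct-sum step extend-zeroSumFree.
-- If S is zero-sumfree with |S| ≥ r(n-1), the hypothesis and (2) give
-- |S|/n ≤ k(S) ≤ r(n-1)/n, so |S| ≤ r(n-1): no sequence of length r(n-1)+1 is
-- zero-sumfree, and together with (3) this means D(C_n^r) = r(n-1)+1
-- (davenportConstant).  When |S| = r(n-1) the chain is tight, and the strict
-- form of (2) forces every term to have order n (cross-tight).

open import Defs
open import Data.Nat using (ℕ; zero; suc; _+_; _*_; _∸_; _≤_; _<_; NonZero; s≤s; z≤n; _≤?_)
open import Data.Nat.Properties
open import Data.Nat.DivMod using (_%_; _mod_; %-distribˡ-+; m%n%n≡m%n; m*n%n≡0; m<n⇒m%n≡m)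
open import Data.Fin using (Fin; toℕ)
import Data.Fin.Properties as FP
open import Data.Vec as V using ([]; _∷_)
open import Data.Vec.Properties using (≡-dec; ∷-injectiveˡ; ∷-injectiveʳ)
open import Data.List as L using (List; []; _∷_; length; _++_)
import Data.List.Properties as LP
open import Data.List.Relation.Binary.Sublist.Propositional using (_⊆_; []; _∷_; _∷ʳ_)
open import Data.List.Relation.Binary.Sublist.Propositional.Properties using (map⁺)
open import Data.List.Relation.Unary.All as All using (All)
open import Data.List.Relation.Unary.Any using (Any; here; there)
open import Data.List.Membership.Propositional using (lose)
open import Data.Product using (_×_; _,_)
open import Data.Integer as ℤ using (+_)
import Data.Integer.Properties as ℤP
import Data.Rational as ℚ
import Data.Rational.Properties as ℚP
open import Data.Rational.Unnormalised as U using (ℚᵘ; *≤*; *<*; *≡*)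
import Data.Rational.Unnormalised.Properties as UP
open import Relation.Nullary using (yes; no; contradiction)
open import Relation.Binary.PropositionalEquality

%-absorbʳ : ∀ a b d .{{_ : NonZero d}} → (a + b % d) % d ≡ (a + b) % d
%-absorbʳ a b d = begin
  (a + b % d) % d          ≡⟨ %-distribˡ-+ a (b % d) d ⟩
  (a % d + b % d % d) % d  ≡⟨ cong (λ x → (a % d + x) % d) (m%n%n≡m%n b d) ⟩
  (a % d + b % d) % d      ≡⟨ %-distribˡ-+ a b d ⟨
  (a + b) % d              ∎
  where open ≡-Reasoning

_·F_ : ∀ {n} .{{_ : NonZero n}} → ℕ → Fin n → Fin n
_·F_ {n} zero    a = 0 mod n
_·F_ {n} (suc k) a = (toℕ a + toℕ (k ·F a)) mod n

toℕ-·F : ∀ {n} .{{_ : NonZero n}} k (a : Fin n) → toℕ (k ·F a) ≡ (k * toℕ a) % n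
toℕ-·F {suc m} zero    a = refl
toℕ-·F {n}     (suc k) a = begin
  toℕ ((toℕ a + toℕ (k ·F a)) mod n)  ≡⟨ FP.toℕ-fromℕ< _ ⟩
  (toℕ a + toℕ (k ·F a)) % n          ≡⟨ cong (λ x → (toℕ a + x) % n) (toℕ-·F k a) ⟩
  (toℕ a + (k * toℕ a) % n) % n       ≡⟨ %-absorbʳ (toℕ a) (k * toℕ a) n ⟩
  (toℕ a + k * toℕ a) % n             ∎
  where open ≡-Reasoning

n·F≡0 : ∀ {n} .{{_ : NonZero n}} (a : Fin n) → n ·F a ≡ 0 mod n
n·F≡0 {suc m} a = FP.toℕ-injective (begin
  toℕ (suc m ·F a)             ≡⟨ toℕ-·F (suc m) a ⟩
  (suc m * toℕ a) % suc m      ≡⟨ cong (_% suc m) (*-comm (suc m) (toℕ a)) ⟩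
  (toℕ a * suc m) % suc m      ≡⟨ m*n%n≡0 (toℕ a) (suc m) ⟩
  toℕ (0 mod suc m)            ∎)
  where open ≡-Reasoning

·G-cons : ∀ {n r} .{{_ : NonZero n}} k (a : Fin n) (g : G n r) →
          _·G_ n (suc r) k (a ∷ g) ≡ (k ·F a) ∷ _·G_ n r k g
·G-cons zero    a g = refl
·G-cons (suc k) a g rewrite ·G-cons k a g = refl

n·G≡0 : ∀ {n r} .{{_ : NonZero n}} (g : G n r) → _·G_ n r n g ≡ 0G n r
n·G≡0 {n} [] with _·G_ n 0 n []
... | [] = refl
n·G≡0 {n} (a ∷ g) rewrite ·G-cons n a g | n·F≡0 a | n·G≡0 g = refl

ordSearch-bound : ∀ {n r} .{{_ : NonZero n}} (g : G n r) f k →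
                  _·G_ n r (suc k + f) g ≡ 0G n r → ordSearch n r (suc f) k g ≤ k + f
ordSearch-bound {n} {r} g f k vanishes
  with ≡-dec FP._≟_ (_·G_ n r (suc k) g) (0G n r)
... | yes _ = m≤m+n k f
ordSearch-bound {n} {r} g zero k vanishes | no nonzero =
  contradiction (subst (λ j → _·G_ n r j g ≡ 0G n r) (+-identityʳ (suc k)) vanishes) nonzero
ordSearch-bound {n} {r} g (suc f) k vanishes | no _ =
  ≤-trans (ordSearch-bound g f (suc k) (subst (λ j → _·G_ n r j g ≡ 0G n r) (+-suc (suc k) f) vanishes))
          (≤-reflexive (sym (+-suc k f)))

ord≤n : ∀ {m r} (g : G (suc m) r) → ord (suc m) r g ≤ suc m
ord≤n {m} g = s≤s (ordSearch-bound g m 0 (n·G≡0 g))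

-- The fraction a/n as an unnormalised rational; cross-number estimates are
-- carried out in ℚᵘ, where fractions need no normalisation.
frac : ℕ → (n : ℕ) .{{_ : NonZero n}} → ℚᵘ
frac a n = (+ a) U./ n

toℚᵘ-/ : ∀ a n .{{_ : NonZero n}} → ℚ.toℚᵘ ((+ a) ℚ./ n) U.≃ frac a n
toℚᵘ-/ a (suc m) = ℚP.toℚᵘ-fromℚᵘ (frac a (suc m))

frac-+ : ∀ a b n .{{_ : NonZero n}} → (frac a n U.+ frac b n) U.≃ frac (a + b) n
frac-+ a b (suc m) = *≡* (begin
  (+ a ℤ.* D ℤ.+ + b ℤ.* D) ℤ.* D  ≡⟨ cong (ℤ._* D) (ℤP.*-distribʳ-+ D (+ a) (+ b)) ⟨
  ((+ a ℤ.+ + b) ℤ.* D) ℤ.* D      ≡⟨ ℤP.*-assoc (+ a ℤ.+ + b) D D ⟩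
  + (a + b) ℤ.* (D ℤ.* D)          ≡⟨ cong (+ (a + b) ℤ.*_) (ℤP.pos-* (suc m) (suc m)) ⟨
  + (a + b) ℤ.* + (suc m * suc m)  ∎)
  where
  open ≡-Reasoning
  D = + suc m

frac-cancel : ∀ {a b n} .{{_ : NonZero n}} → frac a n U.≤ frac b n → a ≤ b
frac-cancel {a} {b} {suc m} (*≤* p) = ℤP.drop‿+≤+ (ℤP.*-cancelʳ-≤-pos (+ a) (+ b) (+ suc m) p)

1/-antitone : ∀ {j k} .{{_ : NonZero j}} .{{_ : NonZero k}} → j ≤ k → frac 1 k U.≤ frac 1 j
1/-antitone {suc j} {suc k} j≤k =
  *≤* (subst₂ ℤ._≤_ (sym (ℤP.*-identityˡ _)) (sym (ℤP.*-identityˡ _)) (ℤ.+≤+ j≤k))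

1/-antitone-< : ∀ {j k} .{{_ : NonZero j}} .{{_ : NonZero k}} → j < k → frac 1 k U.< frac 1 j
1/-antitone-< {suc j} {suc k} j<k =
  *<* (subst₂ ℤ._<_ (sym (ℤP.*-identityˡ _)) (sym (ℤP.*-identityˡ _)) (ℤ.+<+ j<k))

crossᵘ : ∀ {n r} .{{_ : NonZero n}} → List (G n r) → ℚᵘ
crossᵘ {n} {r} S = ℚ.toℚᵘ (crossNumber n r S)

crossᵘ-∷ : ∀ {n r} .{{_ : NonZero n}} (g : G n r) S →
           crossᵘ (g ∷ S) U.≃ (frac 1 (ord n r g) U.+ crossᵘ S)
crossᵘ-∷ {n} {r} g S = UP.≃-trans (ℚP.toℚᵘ-homo-+ ((+ 1) ℚ./ ord n r g) (crossNumber n r S))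
                                   (UP.+-congˡ (crossᵘ S) (toℚᵘ-/ 1 (ord n r g)))

module _ {m r : ℕ} where
  open UP.≤-Reasoning

  -- Since ord(g) ≤ n, every term contributes at least 1/n: k(S) ≥ |S|/n.
  cross≥ : (S : List (G (suc m) r)) → frac (length S) (suc m) U.≤ crossᵘ S
  cross≥ []      = *≤* (ℤ.+≤+ z≤n)
  cross≥ (g ∷ S) = begin
    frac (1 + length S) (suc m)                  ≃⟨ frac-+ 1 (length S) (suc m) ⟨
    frac 1 (suc m) U.+ frac (length S) (suc m)   ≤⟨ UP.+-mono-≤ (1/-antitone (ord≤n g)) (cross≥ S) ⟩
    frac 1 (ord (suc m) r g) U.+ crossᵘ S        ≃⟨ crossᵘ-∷ g S ⟨
    crossᵘ (g ∷ S)                               ∎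

  -- A term of order < n contributes more than 1/n, so then k(S) > |S|/n.
  cross> : (S : List (G (suc m) r)) → Any (λ g → ord (suc m) r g < suc m) S →
           frac (length S) (suc m) U.< crossᵘ S
  cross> (g ∷ S) small = begin-strict
    frac (1 + length S) (suc m)                  ≃⟨ frac-+ 1 (length S) (suc m) ⟨
    frac 1 (suc m) U.+ frac (length S) (suc m)   <⟨ head-or-tail small ⟩
    frac 1 (ord (suc m) r g) U.+ crossᵘ S        ≃⟨ crossᵘ-∷ g S ⟨
    crossᵘ (g ∷ S)                               ∎
    where
    head-or-tail : Any (λ g → ord (suc m) r g < suc m) (g ∷ S) →
                   (frac 1 (suc m) U.+ frac (length S) (suc m)) U.< (frac 1 (ord (suc m) r g) U.+ crossᵘ S)
    head-or-tail (here ord<n) = UP.+-mono-<-≤ (1/-antitone-< ord<n) (cross≥ S)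
    head-or-tail (there p)    = UP.+-mono-≤-< (1/-antitone (ord≤n g)) (cross> S p)

  cross-tight : (S : List (G (suc m) r)) → crossᵘ S U.≤ frac (length S) (suc m) →
                All (λ g → ord (suc m) r g ≡ suc m) S
  cross-tight S minimal = All.tabulate λ {g} g∈S →
    ≤-antisym (ord≤n g) (≮⇒≥ λ ord<n →
      UP.<-irrefl-≡ refl (UP.<-≤-trans (cross> S (lose g∈S ord<n)) minimal))

headSum : ∀ {n r} .{{_ : NonZero n}} → List (G n (suc r)) → Fin n
headSum {n} []            = 0 mod n
headSum {n} ((a ∷ _) ∷ T) = (toℕ a + toℕ (headSum T)) mod n

headTotal : ∀ {n r} → List (G n (suc r)) → ℕ
headTotal []            = 0
headTotal ((a ∷ _) ∷ T) = toℕ a + headTotal T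

σ-split : ∀ {n r} .{{_ : NonZero n}} (T : List (G n (suc r))) →
          σ n (suc r) T ≡ headSum T ∷ σ n r (L.map V.tail T)
σ-split []            = refl
σ-split ((a ∷ g) ∷ T) rewrite σ-split T = refl

toℕ-headSum : ∀ {n r} .{{_ : NonZero n}} (T : List (G n (suc r))) →
              toℕ (headSum T) ≡ headTotal T % n
toℕ-headSum {n} []            = FP.toℕ-fromℕ< _
toℕ-headSum {n} ((a ∷ g) ∷ T) = begin
  toℕ ((toℕ a + toℕ (headSum T)) mod n)  ≡⟨ FP.toℕ-fromℕ< _ ⟩
  (toℕ a + toℕ (headSum T)) % n          ≡⟨ cong (λ x → (toℕ a + x) % n) (toℕ-headSum T) ⟩
  (toℕ a + headTotal T % n) % n          ≡⟨ %-absorbʳ (toℕ a) (headTotal T) n ⟩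
  (toℕ a + headTotal T) % n              ∎
  where open ≡-Reasoning

headTotal-mono : ∀ {n r} {T U : List (G n (suc r))} → T ⊆ U → headTotal T ≤ headTotal U
headTotal-mono []                           = z≤n
headTotal-mono {U = (a ∷ _) ∷ U} (_ ∷ʳ T⊆U) = ≤-trans (headTotal-mono T⊆U) (m≤n+m _ (toℕ a))
headTotal-mono {T = (a ∷ _) ∷ T} (refl ∷ T⊆U) = +-monoʳ-≤ (toℕ a) (headTotal-mono T⊆U)

module _ {m : ℕ} where

  e₁ : ∀ {r} → G (suc m) (suc r)
  e₁ {r} = (1 mod suc m) ∷ 0G (suc m) r

  lift : ∀ {r} → G (suc m) r → G (suc m) (suc r)
  lift g = (0 mod suc m) ∷ g

  extend : ∀ {r} → ℕ → List (G (suc m) r) → List (G (suc m) (suc r))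
  extend k S = L.replicate k e₁ ++ L.map lift S

  tails-⊆ : ∀ {r} {T : List (G (suc m) (suc r))} {S} → T ⊆ L.map lift S → L.map V.tail T ⊆ S
  tails-⊆ {T = T} {S} T⊆ =
    subst (L.map V.tail T ⊆_) (trans (sym (LP.map-∘ S)) (LP.map-id S)) (map⁺ V.tail T⊆)

headTotal-extend : ∀ {m r} k (S : List (G (suc (suc m)) r)) → headTotal (extend k S) ≡ k
headTotal-extend zero    []      = refl
headTotal-extend zero    (g ∷ S) = headTotal-extend zero S
headTotal-extend (suc k) S       = cong suc (headTotal-extend k S)

1+a%d≢0 : ∀ {a d} .{{_ : NonZero d}} → suc a < d → suc a % d ≢ 0
1+a%d≢0 {a} 1+a<d 1+a%d≡0 with trans (sym (m<n⇒m%n≡m 1+a<d)) 1+a%d≡0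
... | ()

-- A zero-sum subsequence either avoids e₁, and then its tail is a zero-sum
-- subsequence of S, or has first coordinate j·1 with 1 ≤ j ≤ k < n.
extend-zeroSumFree : ∀ {m r} {S : List (G (suc m) r)} k → k ≤ m →
                     ZeroSumFree (suc m) r S → ZeroSumFree (suc m) (suc r) (extend k S)
extend-zeroSumFree zero _ zsf [] _ nonempty _ = nonempty refl
extend-zeroSumFree zero _ zsf T@(_ ∷ _) T⊆ _ σ≡0 =
  zsf (L.map V.tail T) (tails-⊆ T⊆) (λ ()) (∷-injectiveʳ (trans (sym (σ-split T)) σ≡0))
extend-zeroSumFree (suc k) 1+k≤m zsf T (_ ∷ʳ T⊆) =
  extend-zeroSumFree k (≤-trans (n≤1+n k) 1+k≤m) zsf T T⊆
extend-zeroSumFree {suc m′} (suc k) (s≤s k≤m′) zsf (_ ∷ T) (refl ∷ T⊆) _ σ≡0 =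
  1+a%d≢0 (s≤s (s≤s bounded)) headVanishes
  where
  bounded : headTotal T ≤ m′
  bounded = ≤-trans (headTotal-mono T⊆) (≤-trans (≤-reflexive (headTotal-extend k _)) k≤m′)
  headVanishes : suc (headTotal T) % suc (suc m′) ≡ 0
  headVanishes = trans (sym (toℕ-headSum (e₁ ∷ T)))
                       (cong toℕ (∷-injectiveˡ (trans (sym (σ-split (e₁ ∷ T))) σ≡0)))

standardSequence : ∀ m r → List (G (suc m) r)
standardSequence m zero    = []
standardSequence m (suc r) = extend m (standardSequence m r)

standardSequence-zeroSumFree : ∀ m r → ZeroSumFree (suc m) r (standardSequence m r)
standardSequence-zeroSumFree m zero    [] [] nonempty _ = nonempty refl
standardSequence-zeroSumFree m (suc r) = extend-zeroSumFree m ≤-refl (standardSequence-zeroSumFree m r)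

length-standardSequence : ∀ m r → length (standardSequence m r) ≡ r * m
length-standardSequence m zero    = refl
length-standardSequence m (suc r) = begin
  length (L.replicate m e₁ ++ L.map lift S)        ≡⟨ LP.length-++ (L.replicate m e₁) ⟩
  length (L.replicate m e₁) + length (L.map lift S) ≡⟨ cong₂ _+_ (LP.length-replicate m) (LP.length-map lift S) ⟩
  m + length S                                      ≡⟨ cong (λ l → m + l) (length-standardSequence m r) ⟩
  m + r * m                                         ∎
  where
  open ≡-Reasoning
  S = standardSequence m r

davenportConstant : ∀ {n r} .{{_ : NonZero n}} L (E : List (G n r)) →
                    ZeroSumFree n r E → length E ≡ L → DavenportBound n r (L + 1) →
                    IsDavenportConstant n r (L + 1)
davenportConstant {n} {r} L E zsf |E|≡L bound = m≤n+m 1 L , bound , minimal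
  where
  minimal : ∀ t → 1 ≤ t → DavenportBound n r t → L + 1 ≤ t
  minimal t _ bound-t with t ≤? L
  ... | yes t≤L = contradiction zsf (bound-t E (subst (t ≤_) (sym |E|≡L) t≤L))
  ... | no  t≰L = subst (_≤ t) (+-comm 1 L) (≰⇒> t≰L)

proposition2p1 : (n r : ℕ) .{{_ : NonZero n}} → .{{_ : NonZero r}} →
    (∀ (S : List (G n r)) → ZeroSumFree n r S → r * (n ∸ 1) ≤ length S →
       crossNumber n r S ℚ.≤ ((+ (r * (n ∸ 1))) ℚ./ n)) →
    IsDavenportConstant n r (r * (n ∸ 1) + 1)
    × (∀ (S : List (G n r)) → ZeroSumFree n r S → length S ≡ r * (n ∸ 1) →
         All (λ g → ord n r g ≡ n) S)
proposition2p1 (suc m) r hypothesis =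
    davenportConstant (r * m) (standardSequence m r) (standardSequence-zeroSumFree m r)
                      (length-standardSequence m r) noLongZeroSumFree
  , onlyOrderN
  where
  crossBound : ∀ S → ZeroSumFree (suc m) r S → r * m ≤ length S → crossᵘ S U.≤ frac (r * m) (suc m)
  crossBound S zsf long = UP.≤-respʳ-≃ (toℚᵘ-/ (r * m) (suc m)) (ℚP.toℚᵘ-mono-≤ (hypothesis S zsf long))

  noLongZeroSumFree : DavenportBound (suc m) r (r * m + 1)
  noLongZeroSumFree S long zsf = ≤⇒≯ short (subst (_≤ length S) (+-comm (r * m) 1) long)
    where
    short : length S ≤ r * m
    short = frac-cancel (UP.≤-trans (cross≥ S) (crossBound S zsf (≤-trans (m≤m+n (r * m) 1) long)))

  onlyOrderN : ∀ S → ZeroSumFree (suc m) r S → length S ≡ r * m → All (λ g → ord (suc m) r g ≡ suc m) S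
  onlyOrderN S zsf |S|≡rm = cross-tight S (subst (λ l → crossᵘ S U.≤ frac l (suc m)) (sym |S|≡rm)
                                                 (crossBound S zsf (≤-reflexive (sym |S|≡rm))))
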